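{- For every integer $k\ge2$, the set of nonnegative integers whose Zeckendorf representation does not contain $F_k$ equals $$\{\,j+\lfloor n\phi\rfloor F_{k-1}+nF_{k-2}-F_k : 0\le j<F_k,\ n\ge1\,\}.$$
   Context: $F_i$ are the Fibonacci numbers ($F_0=0,F_1=1,F_{m+1}=F_m+F_{m-1}$), $\phi=(1+\sqrt5)/2$. The Zeckendorf representation of a positive integer is its unique expression as a sum of Fibonacci numbers $F_i$ with distinct indices $i\ge2$, no two consecutive ($0$ is the empty sum); it "contains $F_k$" if $F_k$ is one of the summands. -}

module Defs where

open import Data.Nat using (ℕ; zero; suc; _+_; _*_; _∸_; _^_; _≤_; _<_)
open import Data.List using (List; []; _∷_; map)
open import Data.Nat.ListAction using (sum)
open import Data.List.Membership.Propositional using (_∈_)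
open import Data.Product using (_×_)
open import Data.Sum using (_⊎_)
open import Relation.Nullary using (¬_)
open import Relation.Binary.PropositionalEquality using (_≡_)

F : ℕ → ℕ
F zero = 0
F (suc zero) = 1
F (suc (suc m)) = F (suc m) + F m

data ZeckIndices : List ℕ → Set where
  z-nil  : ZeckIndices []
  z-one  : ∀ {i} → 2 ≤ i → ZeckIndices (i ∷ [])
  z-cons : ∀ {i j rest} → j + 2 ≤ i → ZeckIndices (j ∷ rest) →
           ZeckIndices (i ∷ j ∷ rest)

IsZeckendorfRep : List ℕ → ℕ → Set
IsZeckendorfRep zs x = ZeckIndices zs × sum (map F zs) ≡ x

-- "the Zeckendorf representation of x does not contain F_k"
-- (the representation exists and is unique by Zeckendorf's theorem)
record ZeckAvoids (k x : ℕ) : Set where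
  constructor avoids
  field
    rep     : List ℕ
    isRep   : IsZeckendorfRep rep x
    notIn   : ¬ (k ∈ rep)

-- m ≤ n·φ, where φ = (1+√5)/2, written out without reals:
-- m ≤ n(1+√5)/2  ⇔  2m − n ≤ n√5  ⇔  2m ≤ n  or  (2m − n)² ≤ 5n²
LePhi : ℕ → ℕ → Set
LePhi m n = (2 * m ≤ n) ⊎ ((n < 2 * m) × ((2 * m ∸ n) ^ 2 ≤ 5 * n ^ 2))

IsFloorPhi : ℕ → ℕ → Set
IsFloorPhi n m = LePhi m n × ¬ LePhi (suc m) n

-- Cut the Zeckendorf representation of x at k: the indices below k sum to some j < F k, and
-- the indices above k, lowered by k - 1, form a Zeckendorf index list L.  By the addition
-- formula F (e + k - 1) = F (k - 1) F (e + 1) + F (k - 2) F e the upper part is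
-- F (k - 1) σ + F (k - 2) N, where N = Σ F e and σ = Σ F (e + 1) over L, so it remains to
-- see that σ + 1 = ⌊(N + 1) φ⌋ for every Zeckendorf index list.  Each such list is built
-- from [] by raising all indices by one, or by raising them by two and adjoining the
-- index 2.  With n = N + 1 and m = σ + 1 these moves act as (n , m) ↦ (m , m + n - 1) and
-- (n , m) ↦ (m + n , 2m + n), and since φ² = φ + 1 both preserve m = ⌊n φ⌋.
module Submission where

open import Defs

module GoldenFloor where

  open import Data.Nat
  open import Data.Nat.Properties
  open import Data.Nat.Tactic.RingSolver using (solve)
  open import Data.List using ([]; _∷_)
  open import Data.Product using (_×_; _,_)
  open import Data.Sum using (inj₁; inj₂)
  open import Relation.Nullary using (¬_; yes; no)
  open import Relation.Binary.PropositionalEquality using (_≡_; sym; cong; module ≡-Reasoning)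

  -- For n > 0 these say m < n φ and m > n φ: as φ is the positive root of x² = x + 1,
  -- m / n < φ iff (m / n)² < m / n + 1.
  LtPhi : ℕ → ℕ → Set
  LtPhi m n = m * m < n * n + n * m

  GtPhi : ℕ → ℕ → Set
  GtPhi m n = n * n + n * m < m * m

  PhiFloor : ℕ → ℕ → Set
  PhiFloor n m = LtPhi m n × GtPhi (suc m) n

  +-balance-< : ∀ {a b c d} → a + b ≡ c + d → c < a → b < d
  +-balance-< {a} {b} {c} {d} eq c<a = +-cancelˡ-< c b d (begin-strict
    c + b <⟨ +-monoˡ-< b c<a ⟩
    a + b ≡⟨ eq ⟩
    c + d ∎)
    where open ≤-Reasoning

  -- With d = 2m - n this turns LtPhi and GtPhi into the form d² ≤ 5 n² used by LePhi.
  golden-identity : ∀ {m n d} → d + n ≡ 2 * m →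
                    4 * (n * n + n * m) + d ^ 2 ≡ 4 * (m * m) + 5 * n ^ 2
  golden-identity {m} {n} {d} d+n≡2m = begin
    4 * (n * n + n * m) + d * (d * 1)            ≡⟨ solve (m ∷ n ∷ d ∷ []) ⟩
    2 * n * (2 * m) + 4 * (n * n) + d * d        ≡⟨ cong (λ e → 2 * n * e + 4 * (n * n) + d * d) d+n≡2m ⟨
    2 * n * (d + n) + 4 * (n * n) + d * d        ≡⟨ solve (m ∷ n ∷ d ∷ []) ⟩
    (d + n) * (d + n) + 5 * (n * n)              ≡⟨ cong (λ e → e * e + 5 * (n * n)) d+n≡2m ⟩
    2 * m * (2 * m) + 5 * (n * n)                ≡⟨ solve (m ∷ n ∷ d ∷ []) ⟩
    4 * (m * m) + 5 * (n * (n * 1))              ∎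
    where open ≡-Reasoning

  LtPhi⇒LePhi : ∀ {m n} → LtPhi m n → LePhi m n
  LtPhi⇒LePhi {m} {n} m<nφ with 2 * m ≤? n
  ... | yes 2m≤n = inj₁ 2m≤n
  ... | no  2m≰n = inj₂ (n<2m , <⇒≤ (+-balance-< (golden-identity {m} {n} (m∸n+n≡m (<⇒≤ n<2m)))
                                                 (*-monoʳ-< 4 m<nφ)))
    where
    n<2m : n < 2 * m
    n<2m = ≰⇒> 2m≰n

  GtPhi⇒¬LePhi : ∀ {m n} → GtPhi m n → ¬ LePhi m n
  GtPhi⇒¬LePhi {m} {n} m>nφ (inj₁ 2m≤n) = <⇒≱ m>nφ (begin
    m * m         ≤⟨ *-monoˡ-≤ m (≤-trans (m≤m+n m (m + 0)) 2m≤n) ⟩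
    n * m         ≤⟨ m≤n+m (n * m) (n * n) ⟩
    n * n + n * m ∎)
    where open ≤-Reasoning
  GtPhi⇒¬LePhi {m} {n} m>nφ (inj₂ (n<2m , d²≤5n²)) =
    <⇒≱ (+-balance-< (sym (golden-identity {m} {n} (m∸n+n≡m (<⇒≤ n<2m)))) (*-monoʳ-< 4 m>nφ)) d²≤5n²

  LePhi-antitone : ∀ {a b n} → b ≤ a → LePhi a n → LePhi b n
  LePhi-antitone b≤a (inj₁ 2a≤n) = inj₁ (≤-trans (*-monoʳ-≤ 2 b≤a) 2a≤n)
  LePhi-antitone {a} {b} {n} b≤a (inj₂ (_ , d²≤5n²)) with 2 * b ≤? n
  ... | yes 2b≤n = inj₁ 2b≤n
  ... | no  2b≰n = inj₂ (≰⇒> 2b≰n ,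
                         ≤-trans (^-monoˡ-≤ 2 (∸-monoˡ-≤ n (*-monoʳ-≤ 2 b≤a))) d²≤5n²)

  IsFloorPhi-unique : ∀ {n m m′} → IsFloorPhi n m → IsFloorPhi n m′ → m ≡ m′
  IsFloorPhi-unique {n} (m≤nφ , nφ<1+m) (m′≤nφ , nφ<1+m′) =
    ≤-antisym (bound m≤nφ nφ<1+m′) (bound m′≤nφ nφ<1+m)
    where
    bound : ∀ {a b} → LePhi a n → ¬ LePhi (suc b) n → a ≤ b
    bound a≤nφ nφ<1+b = ≮⇒≥ (λ b<a → nφ<1+b (LePhi-antitone b<a a≤nφ))

  PhiFloor⇒IsFloorPhi : ∀ {n m} → PhiFloor n m → IsFloorPhi n m
  PhiFloor⇒IsFloorPhi (m<nφ , nφ<1+m) = LtPhi⇒LePhi m<nφ , GtPhi⇒¬LePhi nφ<1+m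

  LtPhi⇒<2* : ∀ {m n} → LtPhi m n → m < 2 * n
  LtPhi⇒<2* {m} {n} m<nφ = ≰⇒> λ 2n≤m → <⇒≱ m<nφ (begin
    n * n + n * m ≤⟨ +-monoˡ-≤ (n * m) (*-monoʳ-≤ n (≤-trans (m≤m+n n (n + 0)) 2n≤m)) ⟩
    n * m + n * m ≡⟨ solve (m ∷ n ∷ []) ⟩
    2 * n * m     ≤⟨ *-monoˡ-≤ m 2n≤m ⟩
    m * m         ∎)
    where open ≤-Reasoning

  PhiFloor-1 : PhiFloor 1 1
  PhiFloor-1 = ≤-refl , ≤-refl

  PhiFloor-+ : ∀ {n m} → PhiFloor n m → PhiFloor (m + n) (m + (m + n))
  PhiFloor-+ {n} {m} (m<nφ , nφ<1+m) = lower , upper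
    where
    open ≤-Reasoning
    lower : LtPhi (m + (m + n)) (m + n)
    lower = begin-strict
      (m + (m + n)) * (m + (m + n))                        ≡⟨ solve (m ∷ n ∷ []) ⟩
      3 * (m * m) + 4 * (m * n) + n * n + m * m            <⟨ +-monoʳ-< _ m<nφ ⟩
      3 * (m * m) + 4 * (m * n) + n * n + (n * n + n * m)  ≡⟨ solve (m ∷ n ∷ []) ⟩
      (m + n) * (m + n) + (m + n) * (m + (m + n))          ∎
    upper : GtPhi (suc (m + (m + n))) (m + n)
    upper = begin-strict
      (m + n) * (m + n) + (m + n) * suc (m + (m + n))                      ≡⟨ solve (m ∷ n ∷ []) ⟩
      3 * (m * m) + 4 * (m * n) + n * n + m + (n * n + n * suc m)          <⟨ +-monoʳ-< _ nφ<1+m ⟩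
      3 * (m * m) + 4 * (m * n) + n * n + m + suc m * suc m                ≤⟨ m≤m+n _ (m + 2 * n) ⟩
      3 * (m * m) + 4 * (m * n) + n * n + m + suc m * suc m + (m + 2 * n)  ≡⟨ solve (m ∷ n ∷ []) ⟩
      suc (m + (m + n)) * suc (m + (m + n))                                ∎

  -- m > (N + 1) φ - 1 > N φ; in the squared-out form the slack is paid for by φ < 2.
  PhiFloor-suc⇒GtPhi : ∀ {N m} → PhiFloor (suc N) m → GtPhi m N
  PhiFloor-suc⇒GtPhi {N} {m} (m<nφ , nφ<1+m) =
    +-cancelʳ-< (2 * m + 1) (N * N + N * m) (m * m) (begin-strict
      N * N + N * m + (2 * m + 1)      ≤⟨ +-monoʳ-≤ (N * N + N * m) 2m+1≤3N+m+2 ⟩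
      N * N + N * m + (3 * N + m + 2)  ≡⟨ solve (N ∷ m ∷ []) ⟩
      suc N * suc N + suc N * suc m    <⟨ nφ<1+m ⟩
      suc m * suc m                    ≡⟨ solve (N ∷ m ∷ []) ⟩
      m * m + (2 * m + 1)              ∎)
    where
    open ≤-Reasoning
    2m+1≤3N+m+2 : 2 * m + 1 ≤ 3 * N + m + 2
    2m+1≤3N+m+2 = begin
      2 * m + 1          ≡⟨ solve (N ∷ m ∷ []) ⟩
      m + suc m          ≤⟨ +-monoʳ-≤ m (LtPhi⇒<2* {m} {suc N} m<nφ) ⟩
      m + 2 * suc N      ≤⟨ m≤m+n (m + 2 * suc N) N ⟩
      m + 2 * suc N + N  ≡⟨ solve (N ∷ m ∷ []) ⟩
      3 * N + m + 2      ∎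

  PhiFloor-∘ : ∀ {N m} → PhiFloor (suc N) m → PhiFloor m (m + N)
  PhiFloor-∘ {N} {m} floor@(m<nφ , _) = lower , upper
    where
    open ≤-Reasoning
    lower : LtPhi (m + N) m
    lower = begin-strict
      (m + N) * (m + N)                ≡⟨ solve (N ∷ m ∷ []) ⟩
      N * N + N * m + (m * m + m * N)  <⟨ +-monoˡ-< (m * m + m * N) (PhiFloor-suc⇒GtPhi {N} {m} floor) ⟩
      m * m + (m * m + m * N)          ≡⟨ solve (N ∷ m ∷ []) ⟩
      m * m + m * (m + N)              ∎
    upper : GtPhi (suc (m + N)) m
    upper = begin-strict
      m * m + m * suc (m + N)                          ≡⟨ solve (N ∷ m ∷ []) ⟩
      m * m + (m * m + m * N + m)                      <⟨ +-monoˡ-< (m * m + m * N + m) m<nφ ⟩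
      suc N * suc N + suc N * m + (m * m + m * N + m)  ≡⟨ solve (N ∷ m ∷ []) ⟩
      suc (m + N) * suc (m + N)                        ∎

module Zeckendorf where

  open GoldenFloor
  open import Data.Nat
  open import Data.Nat.Properties
  open import Algebra.Properties.CommutativeSemigroup +-commutativeSemigroup using (interchange; xy∙z≈xz∙y)
  open import Data.Nat.Tactic.RingSolver using (solve-∀)
  open import Data.Nat.ListAction using (sum)
  open import Data.Nat.ListAction.Properties using (sum-++)
  open import Data.List using (List; []; _∷_; _++_; _∷ʳ_; [_]; map)
  open import Data.List.Properties using (map-∘; map-cong; map-++; map-id-local)
  open import Data.List.Relation.Unary.All as All using (All; []; _∷_)
  open import Data.List.Relation.Unary.All.Properties using (map⁺; map⁻; ++⁺; ++⁻; ++⁻ˡ; All¬⇒¬Any)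
  open import Data.List.Relation.Unary.Any using (here; there)
  open import Data.List.Membership.Propositional using (_∉_)
  open import Data.Product using (_×_; _,_; proj₁; proj₂; ∃-syntax)
  open import Function using (_∘_)
  open import Relation.Binary.Definitions using (tri<; tri≈; tri>)
  open import Relation.Nullary using (yes; no; contradiction)
  open import Relation.Binary.PropositionalEquality
    using (_≡_; refl; sym; trans; cong; cong₂; subst; subst₂; module ≡-Reasoning)

  F-≤-suc : ∀ n → F n ≤ F (suc n)
  F-≤-suc zero    = z≤n
  F-≤-suc (suc n) = m≤m+n (F (suc n)) (F n)

  F-pos : ∀ n → 0 < F (suc n)
  F-pos zero    = ≤-refl
  F-pos (suc n) = ≤-trans (F-pos n) (m≤m+n (F (suc n)) (F n))

  F-mono : ∀ {m n} → m ≤ n → F m ≤ F n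
  F-mono {m} {n} m≤n = subst (λ k → F m ≤ F k) (m∸n+n≡m m≤n) (F-mono-+ (n ∸ m))
    where
    F-mono-+ : ∀ d → F m ≤ F (d + m)
    F-mono-+ zero    = ≤-refl
    F-mono-+ (suc d) = ≤-trans (F-mono-+ d) (F-≤-suc (d + m))

  n<F[2+n] : ∀ n → n < F (2 + n)
  n<F[2+n] zero    = ≤-refl
  n<F[2+n] (suc n) = ≤-trans (+-mono-≤ (F-pos n) (n<F[2+n] n))
                             (≤-reflexive (+-comm (F (suc n)) (F (2 + n))))

  F-+ : ∀ e c → F (e + suc c) ≡ F (suc c) * F (suc e) + F c * F e
  F-+ zero          c = sym (trans (cong₂ _+_ (*-identityʳ (F (suc c))) (*-zeroʳ (F c)))
                                   (+-identityʳ (F (suc c))))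
  F-+ (suc zero)    c = sym (cong₂ _+_ (*-identityʳ (F (suc c))) (*-identityʳ (F c)))
  F-+ (suc (suc e)) c = trans (cong₂ _+_ (F-+ (suc e) c) (F-+ e c))
                              (collect (F (suc c)) (F c) (F (2 + e)) (F (suc e)) (F e))
    where
    collect : ∀ a b x y z → (a * x + b * y) + (a * y + b * z) ≡ a * (x + y) + b * (y + z)
    collect = solve-∀

  sum-map-+ : ∀ (f g : ℕ → ℕ) xs → sum (map (λ x → f x + g x) xs) ≡ sum (map f xs) + sum (map g xs)
  sum-map-+ f g []       = refl
  sum-map-+ f g (x ∷ xs) = trans (cong (f x + g x +_) (sum-map-+ f g xs))
                                 (interchange (f x) (g x) (sum (map f xs)) (sum (map g xs)))

  sum-map-* : ∀ a (f : ℕ → ℕ) xs → sum (map (λ x → a * f x) xs) ≡ a * sum (map f xs)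
  sum-map-* a f []       = sym (*-zeroʳ a)
  sum-map-* a f (x ∷ xs) = trans (cong (a * f x +_) (sum-map-* a f xs))
                                 (sym (*-distribˡ-+ a (f x) (sum (map f xs))))

  value : List ℕ → ℕ
  value L = sum (map F L)

  value-++ : ∀ xs ys → value (xs ++ ys) ≡ value xs + value ys
  value-++ xs ys = trans (cong sum (map-++ F xs ys)) (sum-++ (map F xs) (map F ys))

  value-∷ʳ : ∀ xs i → value (xs ∷ʳ i) ≡ value xs + F i
  value-∷ʳ xs i = trans (value-++ xs [ i ]) (cong (value xs +_) (+-identityʳ (F i)))

  value-shift² : ∀ L → value (map suc (map suc L)) ≡ value (map suc L) + value L
  value-shift² L = begin
    value (map suc (map suc L))          ≡⟨ cong value (map-∘ L) ⟨
    value (map (suc ∘ suc) L)            ≡⟨ cong sum (map-∘ L) ⟨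
    sum (map (λ e → F (suc e) + F e) L)  ≡⟨ sum-map-+ (F ∘ suc) F L ⟩
    sum (map (F ∘ suc) L) + value L      ≡⟨ cong (λ xs → sum xs + value L) (map-∘ L) ⟩
    value (map suc L) + value L          ∎
    where open ≡-Reasoning

  value-shift : ∀ c L → value (map (_+ suc c) L) ≡ F (suc c) * value (map suc L) + F c * value L
  value-shift c L = begin
    value (map (_+ suc c) L)
      ≡⟨ cong sum (map-∘ L) ⟨
    sum (map (λ e → F (e + suc c)) L)
      ≡⟨ cong sum (map-cong (λ e → F-+ e c) L) ⟩
    sum (map (λ e → F (suc c) * F (suc e) + F c * F e) L)
      ≡⟨ sum-map-+ (λ e → F (suc c) * F (suc e)) (λ e → F c * F e) L ⟩
    sum (map (λ e → F (suc c) * F (suc e)) L) + sum (map (λ e → F c * F e) L)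
      ≡⟨ cong₂ _+_ (sum-map-* (F (suc c)) (F ∘ suc) L) (sum-map-* (F c) F L) ⟩
    F (suc c) * sum (map (F ∘ suc) L) + F c * value L
      ≡⟨ cong (λ xs → F (suc c) * sum xs + F c * value L) (map-∘ L) ⟩
    F (suc c) * value (map suc L) + F c * value L
      ∎
    where open ≡-Reasoning

  ZeckIndices-tail : ∀ {i rest} → ZeckIndices (i ∷ rest) → ZeckIndices rest
  ZeckIndices-tail (z-one _)    = z-nil
  ZeckIndices-tail (z-cons _ z) = z

  ZeckIndices-2≤ : ∀ {L} → ZeckIndices L → All (2 ≤_) L
  ZeckIndices-2≤ z-nil                      = []
  ZeckIndices-2≤ (z-one 2≤i)                = 2≤i ∷ []
  ZeckIndices-2≤ (z-cons {j = j} j+2≤i z)   = ≤-trans (m≤n+m 2 j) j+2≤i ∷ ZeckIndices-2≤ z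

  ZeckIndices-gaps : ∀ {i rest} → ZeckIndices (i ∷ rest) → All (λ j → j + 2 ≤ i) rest
  ZeckIndices-gaps (z-one _)                    = []
  ZeckIndices-gaps (z-cons {j = j} j+2≤i z) =
    j+2≤i ∷ All.map (λ x+2≤j → ≤-trans x+2≤j (≤-trans (m≤m+n j 2) j+2≤i)) (ZeckIndices-gaps z)

  ∷-ZeckIndices : ∀ {i L} → 2 ≤ i → All (λ j → j + 2 ≤ i) L → ZeckIndices L → ZeckIndices (i ∷ L)
  ∷-ZeckIndices 2≤i _            z-nil          = z-one 2≤i
  ∷-ZeckIndices _   (j+2≤i ∷ _)  z@(z-one _)    = z-cons j+2≤i z
  ∷-ZeckIndices _   (j+2≤i ∷ _)  z@(z-cons _ _) = z-cons j+2≤i z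

  ZeckIndices-++⁻ : ∀ A {B} → ZeckIndices (A ++ B) → ZeckIndices A × ZeckIndices B
  ZeckIndices-++⁻ []      z = z-nil , z
  ZeckIndices-++⁻ (a ∷ A) z with ZeckIndices-++⁻ A (ZeckIndices-tail z)
  ... | zA , zB = ∷-ZeckIndices (All.head (ZeckIndices-2≤ z)) (++⁻ˡ A (ZeckIndices-gaps z)) zA , zB

  ZeckIndices-++⁺ : ∀ {k A B} → ZeckIndices A → All (k <_) A → ZeckIndices B → All (_< k) B →
                    ZeckIndices (A ++ B)
  ZeckIndices-++⁺ z-nil _ zB _ = zB
  ZeckIndices-++⁺ {k} {a ∷ A} zA (k<a ∷ k<A) zB B<k =
    ∷-ZeckIndices (All.head (ZeckIndices-2≤ zA))
                  (++⁺ (ZeckIndices-gaps zA) (All.map b+2≤a B<k))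
                  (ZeckIndices-++⁺ (ZeckIndices-tail zA) k<A zB B<k)
    where
    b+2≤a : ∀ {b} → b < k → b + 2 ≤ a
    b+2≤a {b} b<k = subst (_≤ a) (+-comm 2 b) (≤-trans (s≤s b<k) k<a)

  ZeckIndices-split : ∀ k {R} → ZeckIndices R → k ∉ R →
                      ∃[ A ] ∃[ B ] (R ≡ A ++ B × All (k <_) A × All (_< k) B)
  ZeckIndices-split k z-nil _ = [] , [] , refl , [] , []
  ZeckIndices-split k {i ∷ rest} z k∉R with <-cmp k i
  ... | tri< k<i _ _ =
    let (A , B , rest≡A++B , k<A , B<k) = ZeckIndices-split k (ZeckIndices-tail z) (k∉R ∘ there)
    in  i ∷ A , B , cong (i ∷_) rest≡A++B , k<i ∷ k<A , B<k
  ... | tri≈ _ k≡i _ = contradiction (here k≡i) k∉R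
  ... | tri> _ _ i<k =
    [] , i ∷ rest , refl , [] ,
    i<k ∷ All.map (λ x+2≤i → ≤-<-trans (m+n≤o⇒m≤o _ x+2≤i) i<k) (ZeckIndices-gaps z)

  ZeckIndices-value< : ∀ {b L} → ZeckIndices L → All (_< suc b) L → value L < F (suc b)
  ZeckIndices-value< {b} z-nil [] = F-pos b
  ZeckIndices-value< {b} {i ∷ rest} z (i<1+b ∷ _) with All.head (ZeckIndices-2≤ z)
  ... | s≤s (s≤s {n = i₂} _) = begin-strict
    F i + value rest  <⟨ +-monoʳ-< (F i) (ZeckIndices-value< (ZeckIndices-tail z) rest<1+i₂) ⟩
    F i + F (suc i₂)  ≤⟨ F-mono i<1+b ⟩
    F (suc b)         ∎
    where
    open ≤-Reasoning
    rest<1+i₂ : All (_< suc i₂) rest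
    rest<1+i₂ = All.map (λ x+2≤i → s≤s (m+n≤o⇒m≤o∸n _ x+2≤i)) (ZeckIndices-gaps z)

  ZeckendorfBelow : ℕ → Set
  ZeckendorfBelow b = ∀ {N} → N < F b → ∃[ L ] (ZeckIndices L × All (_< b) L × value L ≡ N)

  greedy-step : ∀ b → ZeckendorfBelow (suc b) → ZeckendorfBelow (2 + b) → ZeckendorfBelow (3 + b)
  greedy-step b below₁ below₂ {N} N<F[3+b] with N <? F (2 + b)
  ... | yes N<F[2+b] =
    let (L , zL , L<2+b , value≡N) = below₂ N<F[2+b]
    in  L , zL , All.map m<n⇒m<1+n L<2+b , value≡N
  ... | no N≮F[2+b] =
    let (L , zL , L<1+b , value≡r) = below₁ r<F[1+b]
    in  suc (suc b) ∷ L ,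
        ∷-ZeckIndices (s≤s (s≤s z≤n)) (All.map x+2≤2+b L<1+b) zL ,
        ≤-refl ∷ All.map (m<n⇒m<1+n ∘ m<n⇒m<1+n) L<1+b ,
        trans (cong (F (2 + b) +_) value≡r) (m+[n∸m]≡n F[2+b]≤N)
    where
    F[2+b]≤N : F (2 + b) ≤ N
    F[2+b]≤N = ≮⇒≥ N≮F[2+b]
    r<F[1+b] : N ∸ F (2 + b) < F (suc b)
    r<F[1+b] = subst (N ∸ F (2 + b) <_) (m+n∸m≡n (F (2 + b)) (F (suc b)))
                     (∸-monoˡ-< N<F[3+b] F[2+b]≤N)
    x+2≤2+b : ∀ {x} → x < suc b → x + 2 ≤ suc (suc b)
    x+2≤2+b {x} x<1+b = subst (_≤ suc (suc b)) (+-comm 2 x) (s≤s x<1+b)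

  zeckendorf : ∀ b → ZeckendorfBelow b
  zeckendorf zero ()
  zeckendorf (suc zero)       {zero}  _  = [] , z-nil , [] , refl
  zeckendorf (suc zero)       {suc N} (s≤s ())
  zeckendorf (suc (suc zero)) {zero}  _  = [] , z-nil , [] , refl
  zeckendorf (suc (suc zero)) {suc N} (s≤s ())
  zeckendorf (suc (suc (suc b))) = greedy-step b (zeckendorf (suc b)) (zeckendorf (suc (suc b)))

  data ShiftTree : List ℕ → Set where
    []        : ShiftTree []
    shift     : ∀ {L} → ShiftTree L → ShiftTree (map suc L)
    shift²∷ʳ2 : ∀ {L} → ShiftTree L → ShiftTree (map suc (map suc L) ∷ʳ 2)

  ShiftTree-singleton : ∀ {i} → 2 ≤ i → ShiftTree (i ∷ [])
  ShiftTree-singleton {suc zero}          (s≤s ())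
  ShiftTree-singleton {suc (suc zero)}    _ = shift²∷ʳ2 []
  ShiftTree-singleton {suc (suc (suc i))} _ = shift (ShiftTree-singleton (s≤s (s≤s z≤n)))

  ShiftTree-∷ : ∀ {i L} → ShiftTree L → 2 ≤ i → All (λ j → j + 2 ≤ i) L → ShiftTree (i ∷ L)
  ShiftTree-∷ []              2≤i _ = ShiftTree-singleton 2≤i
  ShiftTree-∷ (shift {[]} _)  2≤i _ = ShiftTree-singleton 2≤i
  ShiftTree-∷ (shift {j ∷ L} t) _ (s≤s j+2≤i ∷ gaps) =
    shift (ShiftTree-∷ t (≤-trans (m≤n+m 2 j) j+2≤i) (j+2≤i ∷ All.map s≤s⁻¹ (map⁻ gaps)))
  ShiftTree-∷ (shift²∷ʳ2 {L} t) _ gaps with ++⁻ (map suc (map suc L)) gaps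
  ... | gaps′ , s≤s (s≤s 2≤i) ∷ [] =
    shift²∷ʳ2 (ShiftTree-∷ t 2≤i (All.map (s≤s⁻¹ ∘ s≤s⁻¹) (map⁻ (map⁻ gaps′))))

  ZeckIndices⇒ShiftTree : ∀ {L} → ZeckIndices L → ShiftTree L
  ZeckIndices⇒ShiftTree z-nil          = []
  ZeckIndices⇒ShiftTree (z-one 2≤i)    = ShiftTree-singleton 2≤i
  ZeckIndices⇒ShiftTree z@(z-cons _ z′) =
    ShiftTree-∷ (ZeckIndices⇒ShiftTree z′) (All.head (ZeckIndices-2≤ z)) (ZeckIndices-gaps z)

  ShiftTree⇒PhiFloor : ∀ {L} → ShiftTree L → PhiFloor (suc (value L)) (suc (value (map suc L)))
  ShiftTree⇒PhiFloor [] = PhiFloor-1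
  ShiftTree⇒PhiFloor (shift {L} t) =
    subst (PhiFloor (suc (value (map suc L)))) (cong suc (sym (value-shift² L))) (PhiFloor-∘ (ShiftTree⇒PhiFloor t))
  ShiftTree⇒PhiFloor (shift²∷ʳ2 {L} t) =
    subst₂ PhiFloor (cong suc (sym n≡)) (cong suc (sym m≡)) (PhiFloor-+ (ShiftTree⇒PhiFloor t))
    where
    open ≡-Reasoning
    N σ : ℕ
    N = value L
    σ = value (map suc L)
    n≡ : value (map suc (map suc L) ∷ʳ 2) ≡ σ + suc N
    n≡ = begin
      value (map suc (map suc L) ∷ʳ 2)  ≡⟨ value-∷ʳ (map suc (map suc L)) 2 ⟩
      value (map suc (map suc L)) + 1   ≡⟨ cong (_+ 1) (value-shift² L) ⟩
      σ + N + 1                         ≡⟨ +-assoc σ N 1 ⟩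
      σ + (N + 1)                       ≡⟨ cong (σ +_) (+-comm N 1) ⟩
      σ + suc N                         ∎
    m≡ : value (map suc (map suc (map suc L) ∷ʳ 2)) ≡ σ + suc (σ + suc N)
    m≡ = begin
      value (map suc (map suc (map suc L) ∷ʳ 2))  ≡⟨ cong value (map-++ suc (map suc (map suc L)) [ 2 ]) ⟩
      value (map suc (map suc (map suc L)) ∷ʳ 3)  ≡⟨ value-∷ʳ (map suc (map suc (map suc L))) 3 ⟩
      value (map suc (map suc (map suc L))) + 2   ≡⟨ cong (_+ 2) (value-shift² (map suc L)) ⟩
      value (map suc (map suc L)) + σ + 2         ≡⟨ cong (λ v → v + σ + 2) (value-shift² L) ⟩
      σ + N + σ + 2                               ≡⟨ rearrange σ N ⟩
      σ + suc (σ + suc N)                         ∎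
      where
      rearrange : ∀ a b → a + b + a + 2 ≡ a + suc (a + suc b)
      rearrange = solve-∀

  ZeckIndices⇒PhiFloor : ∀ {L} → ZeckIndices L → PhiFloor (suc (value L)) (suc (value (map suc L)))
  ZeckIndices⇒PhiFloor = ShiftTree⇒PhiFloor ∘ ZeckIndices⇒ShiftTree

  ZeckIndices-map-+ : ∀ c {L} → ZeckIndices L → ZeckIndices (map (_+ c) L)
  ZeckIndices-map-+ c z-nil                    = z-nil
  ZeckIndices-map-+ c (z-one 2≤i)              = z-one (≤-trans 2≤i (m≤m+n _ c))
  ZeckIndices-map-+ c (z-cons {i} {j} j+2≤i z) =
    z-cons (subst (_≤ i + c) (xy∙z≈xz∙y j 2 c) (+-monoˡ-≤ c j+2≤i)) (ZeckIndices-map-+ c z)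

  ZeckIndices-map-∸ : ∀ c {A} → ZeckIndices A → All (2 + c ≤_) A → ZeckIndices (map (_∸ c) A)
  ZeckIndices-map-∸ c z-nil       []            = z-nil
  ZeckIndices-map-∸ c (z-one _)   (2+c≤i ∷ [])  = z-one (m+n≤o⇒m≤o∸n 2 2+c≤i)
  ZeckIndices-map-∸ c (z-cons {i} j+2≤i z) (_ ∷ bounds@(2+c≤j ∷ _)) =
    z-cons (subst (_≤ i ∸ c) (+-∸-comm 2 (m+n≤o⇒n≤o 2 2+c≤j)) (∸-monoˡ-≤ c j+2≤i))
           (ZeckIndices-map-∸ c z bounds)

  map-∸-+ : ∀ c {A} → All (c ≤_) A → map (_+ c) (map (_∸ c) A) ≡ A
  map-∸-+ c {A} c≤A = trans (sym (map-∘ A)) (map-id-local (All.map m∸n+n≡m c≤A))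

  ZeckAvoids⇒split : ∀ s {v} → ZeckAvoids (2 + s) v →
                     ∃[ j ] ∃[ L ] (j < F (2 + s) × ZeckIndices L × value (map (_+ suc s) L) + j ≡ v)
  ZeckAvoids⇒split s (avoids R (zR , refl) k∉R) with ZeckIndices-split (2 + s) zR k∉R
  ... | A , B , refl , k<A , B<k =
    value B , map (_∸ suc s) A , ZeckIndices-value< zB B<k , ZeckIndices-map-∸ (suc s) zA k<A ,
    trans (cong (λ A′ → value A′ + value B) (map-∸-+ (suc s) (All.map (m+n≤o⇒n≤o 2) k<A)))
          (sym (value-++ A B))
    where
    zA : ZeckIndices A
    zA = proj₁ (ZeckIndices-++⁻ A zR)
    zB : ZeckIndices B
    zB = proj₂ (ZeckIndices-++⁻ A zR)

  split⇒ZeckAvoids : ∀ s {j L} → j < F (2 + s) → ZeckIndices L →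
                     ZeckAvoids (2 + s) (value (map (_+ suc s) L) + j)
  split⇒ZeckAvoids s {L = L} j<F zL with zeckendorf (2 + s) j<F
  ... | B , zB , B<k , refl =
    avoids (A ++ B) (ZeckIndices-++⁺ (ZeckIndices-map-+ (suc s) zL) k<A zB B<k , value-++ A B)
           (All¬⇒¬Any (++⁺ (All.map <⇒≢ k<A) (All.map >⇒≢ B<k)))
    where
    A : List ℕ
    A = map (_+ suc s) L
    k<A : All (2 + s <_) A
    k<A = map⁺ (All.map (+-monoˡ-≤ (suc s)) (ZeckIndices-2≤ zL))

  -- x + F k = j + m F (k - 1) + n F (k - 2) for m = σ + 1 and n = N + 1
  split-identity : ∀ s L j → value (map (_+ suc s) L) + j + F (2 + s) ≡
                             j + suc (value (map suc L)) * F (suc s) + suc (value L) * F s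
  split-identity s L j =
    trans (cong (λ u → u + j + F (2 + s)) (value-shift s L))
          (collect (F (suc s)) (F s) (value (map suc L)) (value L) j)
    where
    collect : ∀ a b σ N j → a * σ + b * N + j + (a + b) ≡ j + suc σ * a + suc N * b
    collect = solve-∀

  ZeckAvoids⇒floor : ∀ s {v} → ZeckAvoids (2 + s) v →
    ∃[ j ] ∃[ n ] ∃[ m ] (j < F (2 + s) × 1 ≤ n × IsFloorPhi n m ×
                          v + F (2 + s) ≡ j + m * F (suc s) + n * F s)
  ZeckAvoids⇒floor s avoid with ZeckAvoids⇒split s avoid
  ... | j , L , j<F , zL , refl =
    j , suc (value L) , suc (value (map suc L)) , j<F , s≤s z≤n ,
    PhiFloor⇒IsFloorPhi (ZeckIndices⇒PhiFloor zL) , split-identity s L j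

  floor⇒ZeckAvoids : ∀ s {j n m} → j < F (2 + s) → 1 ≤ n → IsFloorPhi n m →
    ∃[ v ] (v + F (2 + s) ≡ j + m * F (suc s) + n * F s × ZeckAvoids (2 + s) v)
  floor⇒ZeckAvoids s {j} {suc N} {m} j<F (s≤s z≤n) n-floor with zeckendorf (2 + N) (n<F[2+n] N)
  ... | L , zL , _ , refl =
    value (map (_+ suc s) L) + j ,
    trans (split-identity s L j) (cong (λ m′ → j + m′ * F (suc s) + suc (value L) * F s) σ+1≡m) ,
    split⇒ZeckAvoids s j<F zL
    where
    σ+1≡m : suc (value (map suc L)) ≡ m
    σ+1≡m = IsFloorPhi-unique (PhiFloor⇒IsFloorPhi (ZeckIndices⇒PhiFloor zL)) n-floor

open Zeckendorf using (ZeckAvoids⇒floor; floor⇒ZeckAvoids)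
import Data.Nat as ℕ
open import Data.Nat using (ℕ; _≤_; _<_; _∸_; suc; z≤n; s≤s)
open import Data.Integer using (ℤ; +_; _+_; _*_; _-_; -_; ∣_∣; 0ℤ; +≤+) renaming (_≤_ to _≤ℤ_)
open import Data.Integer.Properties using (pos-+; pos-*; 0≤i⇒+∣i∣≡i; +-assoc; +-inverseʳ; +-identityʳ)
open import Data.Product using (_×_; _,_; ∃-syntax)
open import Function.Bundles using (_⇔_; mk⇔)
open import Relation.Binary.PropositionalEquality using (_≡_; sym; trans; cong; cong₂; subst; module ≡-Reasoning)

ℤ-offset : ∀ {v c} j m n a b → v ℕ.+ c ≡ j ℕ.+ m ℕ.* a ℕ.+ n ℕ.* b →
           + v ≡ (+ j + + m * + a + + n * + b) - + c
ℤ-offset {v} {c} j m n a b eq = begin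
  + v                                    ≡⟨ +-identityʳ (+ v) ⟨
  + v + 0ℤ                               ≡⟨ cong (_+_ (+ v)) (+-inverseʳ (+ c)) ⟨
  + v + (+ c - + c)                      ≡⟨ +-assoc (+ v) (+ c) (- + c) ⟨
  + v + + c - + c                        ≡⟨ cong (_- + c) (pos-+ v c) ⟨
  + (v ℕ.+ c) - + c                      ≡⟨ cong (λ e → + e - + c) eq ⟩
  + (j ℕ.+ m ℕ.* a ℕ.+ n ℕ.* b) - + c   ≡⟨ cong (_- + c) pos-sum ⟩
  (+ j + + m * + a + + n * + b) - + c    ∎
  where
  open ≡-Reasoning
  pos-sum : + (j ℕ.+ m ℕ.* a ℕ.+ n ℕ.* b) ≡ + j + + m * + a + + n * + b
  pos-sum = trans (pos-+ (j ℕ.+ m ℕ.* a) (n ℕ.* b))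
                  (cong₂ _+_ (trans (pos-+ j (m ℕ.* a)) (cong (_+_ (+ j)) (pos-* m a))) (pos-* n b))

theorem11 : (k : ℕ) → 2 ≤ k → (x : ℤ) →
    ((0ℤ ≤ℤ x) × ZeckAvoids k ∣ x ∣)
      ⇔ (∃[ j ] ∃[ n ] ∃[ m ] (j < F k × 1 ≤ n × IsFloorPhi n m ×
           x ≡ (+ j + + m * + F (k ∸ 1) + + n * + F (k ∸ 2)) - + F k))
theorem11 (suc (suc s)) (s≤s (s≤s z≤n)) x = mk⇔
  (λ (0≤x , avoid) →
     let (j , n , m , j<F , 1≤n , n-floor , eq) = ZeckAvoids⇒floor s avoid
     in  j , n , m , j<F , 1≤n , n-floor ,
         trans (sym (0≤i⇒+∣i∣≡i 0≤x)) (ℤ-offset j m n (F (suc s)) (F s) eq))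
  (λ (j , n , m , j<F , 1≤n , n-floor , x≡) →
     let (v , eq , avoid) = floor⇒ZeckAvoids s j<F 1≤n n-floor
     in  subst (λ y → 0ℤ ≤ℤ y × ZeckAvoids (2 ℕ.+ s) ∣ y ∣)
               (trans (ℤ-offset j m n (F (suc s)) (F s) eq) (sym x≡))
               (+≤+ z≤n , avoid))
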